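{- Let $n$ be a positive integer and let $\sigma$ be a derangement of $[n]=\{1,\dots,n\}$ (so $n\ge 2$). For each derangement $d\in D_n$, play permutation wordle with secret permutation $d$, first guess $\gamma_1=[1,2,\dots,n]$, and second guess $\gamma_2$ formed from $\gamma_1$ using the strategy component $\sigma$ (since $d$ is a derangement, every position of $\gamma_1$ is incorrect, so $\gamma_2(\sigma(j))=\gamma_1(j)=j$ for all $j$, i.e. $\gamma_2=\sigma^{ -1}$). Let $\mathcal{J}_2(d)=\{i\in[n] : \gamma_2(i)=d(i)\}$. Then \[\frac{1}{|D_n|}\sum_{d\in D_n}|\mathcal{J}_2(d)| = \frac{n}{n-1}.\]
   Context: $D_n$ denotes the set of derangements of $[n]$ (permutations with no fixed points). Permutations are written in one-line notation $[\pi(1),\dots,\pi(n)]$. Permutation wordle: a secret permutation $\pi$ of $[n]$ is fixed; the guesser makes guesses $\gamma_1,\gamma_2,\dots$ (permutations of $[n]$) and after guess $\gamma_r$ learns the set of correct positions $\mathcal{J}_r=\{i:\gamma_r(i)=\pi(i)\}$; $\mathcal{I}_r=[n]\setminus\mathcal{J}_r$. Given a permutation $\sigma$ of $[k]$ with $k=|\mathcal{I}_r|$ and $\mathcal{I}_r=\{i_1<\dots<i_k\}$, the next guess formed using $\sigma$ is: $\gamma_{r+1}(i)=\gamma_r(i)$ for $i\in\mathcal{J}_r$ and $\gamma_{r+1}(i_{\sigma(j)})=\gamma_r(i_j)$ for $j=1,\dots,k$. -}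

module Defs where

open import Data.Nat using (ℕ)
open import Data.Fin using (Fin; _≟_)
open import Data.Fin.Properties using (any?)
open import Data.Vec using (Vec; lookup; tabulate)
open import Data.List using (List; length; filter; allFin)
open import Data.Product using (_×_; _,_; ∃)
open import Relation.Nullary using (¬_; yes; no)
open import Relation.Binary.PropositionalEquality using (_≡_)

-- Permutations of [n] in one-line notation: a vector [π(1),…,π(n)] over Fin n
-- with pairwise distinct entries (injective, hence bijective on a finite set).
IsPerm : ∀ {n} → Vec (Fin n) n → Set
IsPerm v = ∀ i j → lookup v i ≡ lookup v j → i ≡ j

IsDerangement : ∀ {n} → Vec (Fin n) n → Set
IsDerangement v = IsPerm v × (∀ i → ¬ (lookup v i ≡ i))

identityGuess : ∀ n → Vec (Fin n) n
identityGuess n = tabulate (λ i → i)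

-- Next guess formed from γ using σ when every position of γ is incorrect
-- (so 𝓘 = [n], i_j = j):  γ'(σ(j)) = γ(j).  Position i gets γ(j) for the j
-- with σ(j) = i (unique and existing when σ is a permutation; the fallback
-- branch is unreachable for permutations σ).
nextGuessAllWrong : ∀ {n} → Vec (Fin n) n → Vec (Fin n) n → Vec (Fin n) n
nextGuessAllWrong {n} γ σ = tabulate pick
  where
  pick : Fin n → Fin n
  pick i with any? (λ j → lookup σ j ≟ i)
  ... | yes (j , _) = lookup γ j
  ... | no _ = i

numCorrect : ∀ {n} → Vec (Fin n) n → Vec (Fin n) n → ℕ
numCorrect {n} γ d = length (filter (λ i → lookup γ i ≟ lookup d i) (allFin n))

J2size : ∀ {n} → Vec (Fin n) n → Vec (Fin n) n → ℕ
J2size {n} σ d = numCorrect (nextGuessAllWrong (identityGuess n) σ) d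

-- Write N(i, j) for the number of derangements d with d(i) = j.  Then N(i, i) = 0,
-- and conjugating by the transposition (j j′) permutes the derangements while
-- fixing i, so N(i, j) = N(i, j′) for all j, j′ ≠ i.  As Σⱼ N(i, j) = |Dₙ|, this
-- gives (n − 1) N(i, j) = |Dₙ| for j ≠ i.  The second guess is γ₂ = σ⁻¹, which has
-- no fixed points, so Σ_d |𝓙₂(d)| = Σᵢ N(i, γ₂(i)) = n |Dₙ| / (n − 1).
module Submission where

open import Defs
open import Data.Nat using (ℕ; suc; _+_; _*_; _∸_)
open import Data.Nat.Properties
  using (<-irrefl; *-comm; +-identityʳ; *-identityʳ; *-zeroʳ; *-distribˡ-+; *-distribʳ-∸; m+n∸n≡m)
open import Data.Nat.ListAction using (sum)
open import Data.Nat.ListAction.Properties using (sum-↭)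
open import Data.Nat.Tactic.RingSolver using (solve-∀)
open import Data.Fin using (Fin; punchOut) renaming (zero to 0F; suc to sucF)
open import Data.Fin.Properties using (_≟_; any?; punchOut-injective; injective⇒≤)
open import Data.Fin.Permutation using (Permutation′; _⟨$⟩ʳ_; _⟨$⟩ˡ_; inverseˡ; flip; transpose)
import Data.Fin.Permutation.Components as PC
open import Data.Vec using (Vec; lookup; tabulate)
open import Data.Vec.Properties using (lookup∘tabulate; tabulate∘lookup; tabulate-cong)
open import Data.List using (List; []; _∷_; length; map; filter; allFin)
open import Data.List.Properties using (map-tabulate; map-∘; length-tabulate)
open import Data.List.Relation.Binary.Permutation.Propositional using (_↭_)
import Data.List.Relation.Binary.Permutation.Propositional.Properties as ↭
open import Data.List.Relation.Binary.BagAndSetEquality using (∼bag⇒↭)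
open import Data.List.Membership.Propositional using (_∈_)
open import Data.List.Membership.Propositional.Properties using (∈-map⁺; ∈-map⁻)
open import Data.List.Membership.Propositional.Properties.WithK using (unique∧set⇒bag)
open import Data.List.Relation.Unary.Unique.Propositional using (Unique)
import Data.List.Relation.Unary.Unique.Propositional.Properties as Unique
open import Data.List.Relation.Unary.Any using (here; there)
open import Data.Bool using (true; false; if_then_else_)
open import Data.Product using (_,_; ∃; proj₂)
open import Function using (_∘_; Injective; Equivalence; mk⇔)
open import Function.Bundles using (_⇔_; Injection)
open import Function.Properties.Inverse using (↔⇒↣)
open import Relation.Nullary using (does; yes; no; contradiction)
open import Relation.Unary using (Decidable)
open import Relation.Binary.PropositionalEquality
  using (_≡_; _≢_; refl; sym; trans; cong; cong₂; subst; subst₂; module ≡-Reasoning)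

private
  variable
    A B : Set
    n : ℕ

∑ : List A → (A → ℕ) → ℕ
∑ xs f = sum (map f xs)

syntax ∑ xs (λ x → e) = ∑[ x ∈ xs ] e

∑-cong : ∀ {f g : A → ℕ} (xs : List A) → (∀ {x} → x ∈ xs → f x ≡ g x) → ∑ xs f ≡ ∑ xs g
∑-cong []       f≡g = refl
∑-cong (x ∷ xs) f≡g = cong₂ _+_ (f≡g (here refl)) (∑-cong xs (f≡g ∘ there))

∑-const : (xs : List A) (c : ℕ) → ∑[ _ ∈ xs ] c ≡ length xs * c
∑-const []       c = refl
∑-const (x ∷ xs) c = cong (c +_) (∑-const xs c)

∑-+ : ∀ (f g : A → ℕ) xs → ∑[ x ∈ xs ] (f x + g x) ≡ ∑ xs f + ∑ xs g
∑-+ f g []       = refl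
∑-+ f g (x ∷ xs) = begin
  f x + g x + ∑[ y ∈ xs ] (f y + g y)     ≡⟨ cong (f x + g x +_) (∑-+ f g xs) ⟩
  f x + g x + (∑ xs f + ∑ xs g)           ≡⟨ +-interchange (f x) (g x) (∑ xs f) (∑ xs g) ⟩
  f x + ∑ xs f + (g x + ∑ xs g)           ∎
  where
  open ≡-Reasoning
  +-interchange : ∀ a b c d → a + b + (c + d) ≡ a + c + (b + d)
  +-interchange = solve-∀

∑-*ˡ : ∀ c (f : A → ℕ) xs → ∑[ x ∈ xs ] (c * f x) ≡ c * ∑ xs f
∑-*ˡ c f []       = sym (*-zeroʳ c)
∑-*ˡ c f (x ∷ xs) = trans (cong (c * f x +_) (∑-*ˡ c f xs)) (sym (*-distribˡ-+ c (f x) (∑ xs f)))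

∑-comm : ∀ (f : A → B → ℕ) xs ys → ∑[ x ∈ xs ] ∑[ y ∈ ys ] f x y ≡ ∑[ y ∈ ys ] ∑[ x ∈ xs ] f x y
∑-comm f []       ys = sym (trans (∑-const ys 0) (*-zeroʳ (length ys)))
∑-comm f (x ∷ xs) ys =
  trans (cong (∑ ys (f x) +_) (∑-comm f xs ys)) (sym (∑-+ (f x) (λ y → ∑[ x′ ∈ xs ] f x′ y) ys))

∑-↭ : ∀ {xs ys : List A} (f : A → ℕ) → xs ↭ ys → ∑ xs f ≡ ∑ ys f
∑-↭ f xs↭ys = sum-↭ (↭.map⁺ f xs↭ys)

length-filter≡∑ : ∀ {P : A → Set} (P? : Decidable P) xs →
  length (filter P? xs) ≡ ∑[ x ∈ xs ] (if does (P? x) then 1 else 0)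
length-filter≡∑ P? []       = refl
length-filter≡∑ P? (x ∷ xs) with does (P? x)
... | true  = cong suc (length-filter≡∑ P? xs)
... | false = length-filter≡∑ P? xs

∑-allFin-suc : (f : Fin (suc n) → ℕ) → ∑ (allFin (suc n)) f ≡ f 0F + ∑[ j ∈ allFin n ] f (sucF j)
∑-allFin-suc {n} f = cong (f 0F +_) (trans (cong sum (map-tabulate sucF f)) (sym (cong sum (map-tabulate (λ j → j) (f ∘ sucF)))))

∑-allFin-const : ∀ n c → ∑[ _ ∈ allFin n ] c ≡ n * c
∑-allFin-const n c = trans (∑-const (allFin n) c) (cong (_* c) (length-tabulate {n = n} (λ j → j)))

map-bijection-↭ : ∀ {xs : List A} (f g : A → A) → Unique xs →
  (∀ {x} → x ∈ xs → f x ∈ xs) → (∀ {x} → x ∈ xs → g x ∈ xs) →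
  (∀ x → g (f x) ≡ x) → (∀ x → f (g x) ≡ x) → map f xs ↭ xs
map-bijection-↭ {xs = xs} f g xs-unique f-closed g-closed gf≡id fg≡id =
  ∼bag⇒↭ (unique∧set⇒bag (Unique.map⁺ f-injective xs-unique) xs-unique (mk⇔ to from))
  where
  f-injective : ∀ {x y} → f x ≡ f y → x ≡ y
  f-injective {x} {y} fx≡fy = trans (sym (gf≡id x)) (trans (cong g fx≡fy) (gf≡id y))
  to : ∀ {y} → y ∈ map f xs → y ∈ xs
  to y∈fxs with x , x∈xs , refl ← ∈-map⁻ f y∈fxs = f-closed x∈xs
  from : ∀ {y} → y ∈ xs → y ∈ map f xs
  from {y} y∈xs = subst (_∈ map f xs) (fg≡id y) (∈-map⁺ f (g-closed y∈xs))

δ : Fin n → Fin n → ℕ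
δ a b = if does (a ≟ b) then 1 else 0

δ-refl : (a : Fin n) → δ a a ≡ 1
δ-refl a with a ≟ a
... | yes _   = refl
... | no a≢a = contradiction refl a≢a

δ-≢ : {a b : Fin n} → a ≢ b → δ a b ≡ 0
δ-≢ {a = a} {b} a≢b with a ≟ b
... | yes a≡b = contradiction a≡b a≢b
... | no _    = refl

δ-injective : ∀ {f : Fin n → Fin n} → Injective _≡_ _≡_ f → ∀ a b → δ (f a) (f b) ≡ δ a b
δ-injective {f = f} f-injective a b with a ≟ b
... | yes refl = δ-refl (f a)
... | no a≢b   = δ-≢ (a≢b ∘ f-injective)

∑-δ : (a : Fin n) → ∑[ j ∈ allFin n ] δ j a ≡ 1
∑-δ {suc n} 0F       = trans (∑-allFin-suc {n} (λ j → δ j 0F)) (cong suc (trans (∑-allFin-const n 0) (*-zeroʳ n)))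
∑-δ {suc n} (sucF a) = trans (∑-allFin-suc {n} (λ j → δ j (sucF a))) (∑-δ a)

injective⇒surjective : ∀ {f : Fin n → Fin n} → Injective _≡_ _≡_ f → ∀ i → ∃ λ j → f j ≡ i
injective⇒surjective {suc m} {f} f-injective i with any? (λ j → f j ≟ i)
... | yes found = found
... | no ∄j     = contradiction (injective⇒≤ punchOut∘f-injective) (<-irrefl refl)
  where
  -- with i missed, f would squeeze Fin (suc m) injectively into Fin m
  i≢f : ∀ k → i ≢ f k
  i≢f k i≡fk = ∄j (k , sym i≡fk)
  punchOut∘f : Fin (suc m) → Fin m
  punchOut∘f k = punchOut (i≢f k)
  punchOut∘f-injective : Injective _≡_ _≡_ punchOut∘f
  punchOut∘f-injective {x} {y} = f-injective ∘ punchOut-injective (i≢f x) (i≢f y)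

transpose-matchˡ : (i j : Fin n) → PC.transpose i j i ≡ j
transpose-matchˡ i j with i ≟ i
... | yes _   = refl
... | no i≢i = contradiction refl i≢i

transpose-fixed : {i j k : Fin n} → k ≢ i → k ≢ j → PC.transpose i j k ≡ k
transpose-fixed {i = i} {j} {k} k≢i k≢j with k ≟ i
... | yes k≡i = contradiction k≡i k≢i
... | no _ with k ≟ j
...   | yes k≡j = contradiction k≡j k≢j
...   | no _    = refl

-- Taking v explicitly lets f be found by unification, even when it is a local function.
lookup-tabulate : ∀ {f : Fin n → A} (v : Vec A n) → v ≡ tabulate f → ∀ i → lookup v i ≡ f i
lookup-tabulate _ refl = lookup∘tabulate _

secondGuess-inverse : (σ : Vec (Fin n) n) → IsPerm σ → ∀ i →
  lookup σ (lookup (nextGuessAllWrong (identityGuess n) σ) i) ≡ i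
secondGuess-inverse {n} σ σ-perm i
  rewrite lookup-tabulate (nextGuessAllWrong (identityGuess n) σ) refl i
  with any? (λ j → lookup σ j ≟ i)
... | yes (j , σj≡i) rewrite lookup∘tabulate (λ k → k) j = σj≡i
... | no ∄j = contradiction (injective⇒surjective (σ-perm _ _) i) ∄j

secondGuess-fixedPointFree : (σ : Vec (Fin n) n) → IsDerangement σ → ∀ i →
  lookup (nextGuessAllWrong (identityGuess n) σ) i ≢ i
secondGuess-fixedPointFree σ (σ-perm , σ-fpf) i γ₂i≡i =
  σ-fpf i (trans (cong (lookup σ) (sym γ₂i≡i)) (secondGuess-inverse σ σ-perm i))

numCorrect≡∑δ : (γ d : Vec (Fin n) n) → numCorrect γ d ≡ ∑[ i ∈ allFin n ] δ (lookup γ i) (lookup d i)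
numCorrect≡∑δ {n} γ d = length-filter≡∑ (λ i → lookup γ i ≟ lookup d i) (allFin n)

vec-ext : {u v : Vec A n} → (∀ i → lookup u i ≡ lookup v i) → u ≡ v
vec-ext {u = u} {v} u≗v = trans (sym (tabulate∘lookup u)) (trans (tabulate-cong u≗v) (tabulate∘lookup v))

⟨$⟩ʳ-injective : (π : Permutation′ n) → Injective _≡_ _≡_ (π ⟨$⟩ʳ_)
⟨$⟩ʳ-injective π = Injection.injective (↔⇒↣ π)

conjugate : Permutation′ n → Vec (Fin n) n → Vec (Fin n) n
conjugate π d = tabulate (λ k → π ⟨$⟩ʳ lookup d (π ⟨$⟩ˡ k))

lookup-conjugate : ∀ (π : Permutation′ n) d i → lookup (conjugate π d) (π ⟨$⟩ʳ i) ≡ π ⟨$⟩ʳ lookup d i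
lookup-conjugate π d i = trans (lookup∘tabulate _ (π ⟨$⟩ʳ i)) (cong (λ k → π ⟨$⟩ʳ lookup d k) (inverseˡ π))

conjugate-flip : ∀ (π : Permutation′ n) d → conjugate (flip π) (conjugate π d) ≡ d
conjugate-flip π d = vec-ext λ i → begin
  lookup (conjugate (flip π) (conjugate π d)) i  ≡⟨ lookup∘tabulate _ i ⟩
  π ⟨$⟩ˡ lookup (conjugate π d) (π ⟨$⟩ʳ i)       ≡⟨ cong (π ⟨$⟩ˡ_) (lookup-conjugate π d i) ⟩
  π ⟨$⟩ˡ (π ⟨$⟩ʳ lookup d i)                     ≡⟨ inverseˡ π ⟩
  lookup d i                                     ∎
  where open ≡-Reasoning

conjugate-isDerangement : ∀ (π : Permutation′ n) {d} → IsDerangement d → IsDerangement (conjugate π d)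
conjugate-isDerangement π {d} (d-perm , d-fpf) = conj-perm , conj-fpf
  where
  conj-perm : IsPerm (conjugate π d)
  conj-perm a b eq = ⟨$⟩ʳ-injective (flip π) (d-perm _ _ (⟨$⟩ʳ-injective π
    (trans (sym (lookup∘tabulate _ a)) (trans eq (lookup∘tabulate _ b)))))
  conj-fpf : ∀ k → lookup (conjugate π d) k ≢ k
  conj-fpf k eq = d-fpf (π ⟨$⟩ˡ k) (trans (sym (inverseˡ π))
    (cong (π ⟨$⟩ˡ_) (trans (sym (lookup∘tabulate _ k)) eq)))

module DerangementCounts
  (Dn : List (Vec (Fin n) n)) (Dn-unique : Unique Dn) (Dn-enumerates : ∀ d → (d ∈ Dn) ⇔ IsDerangement d)
  where

  countMapsTo : Fin n → Fin n → ℕ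
  countMapsTo i j = ∑[ d ∈ Dn ] δ j (lookup d i)

  conjugate-∈ : ∀ (π : Permutation′ n) {d} → d ∈ Dn → conjugate π d ∈ Dn
  conjugate-∈ π {d} d∈Dn = Equivalence.from (Dn-enumerates _)
    (conjugate-isDerangement π {d} (Equivalence.to (Dn-enumerates d) d∈Dn))

  ∑-conjugate : ∀ (π : Permutation′ n) (h : Vec (Fin n) n → ℕ) → ∑[ d ∈ Dn ] h (conjugate π d) ≡ ∑ Dn h
  ∑-conjugate π h = trans (cong sum (map-∘ Dn)) (∑-↭ h (map-bijection-↭ (conjugate π) (conjugate (flip π))
    Dn-unique (conjugate-∈ π) (conjugate-∈ (flip π)) (conjugate-flip π) (conjugate-flip (flip π))))

  countMapsTo-conjugate : ∀ (π : Permutation′ n) i j → countMapsTo (π ⟨$⟩ʳ i) (π ⟨$⟩ʳ j) ≡ countMapsTo i j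
  countMapsTo-conjugate π i j = begin
    ∑[ d ∈ Dn ] δ (π ⟨$⟩ʳ j) (lookup d (π ⟨$⟩ʳ i))                   ≡⟨ ∑-conjugate π _ ⟨
    ∑[ d ∈ Dn ] δ (π ⟨$⟩ʳ j) (lookup (conjugate π d) (π ⟨$⟩ʳ i))     ≡⟨ ∑-cong Dn (λ {d} _ → cong (δ (π ⟨$⟩ʳ j)) (lookup-conjugate π d i)) ⟩
    ∑[ d ∈ Dn ] δ (π ⟨$⟩ʳ j) (π ⟨$⟩ʳ lookup d i)                     ≡⟨ ∑-cong Dn (λ {d} _ → δ-injective (⟨$⟩ʳ-injective π) j (lookup d i)) ⟩
    ∑[ d ∈ Dn ] δ j (lookup d i)                                     ∎
    where
    open ≡-Reasoning

  countMapsTo-diagonal : ∀ i → countMapsTo i i ≡ 0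
  countMapsTo-diagonal i = trans (∑-cong Dn d-fpf) (trans (∑-const Dn 0) (*-zeroʳ (length Dn)))
    where
    d-fpf : ∀ {d} → d ∈ Dn → δ i (lookup d i) ≡ 0
    d-fpf {d} d∈Dn = δ-≢ (proj₂ (Equivalence.to (Dn-enumerates d) d∈Dn) i ∘ sym)

  ∑-countMapsTo : ∀ i → ∑[ j ∈ allFin n ] countMapsTo i j ≡ length Dn
  ∑-countMapsTo i = begin
    ∑[ j ∈ allFin n ] ∑[ d ∈ Dn ] δ j (lookup d i)   ≡⟨ ∑-comm (λ j d → δ j (lookup d i)) (allFin n) Dn ⟩
    ∑[ d ∈ Dn ] ∑[ j ∈ allFin n ] δ j (lookup d i)   ≡⟨ ∑-cong Dn (λ {d} _ → ∑-δ (lookup d i)) ⟩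
    ∑[ d ∈ Dn ] 1                                    ≡⟨ ∑-const Dn 1 ⟩
    length Dn * 1                                    ≡⟨ *-identityʳ (length Dn) ⟩
    length Dn                                        ∎
    where open ≡-Reasoning

  countMapsTo-offDiagonal-constant : ∀ {i j j′} → j ≢ i → j′ ≢ i → countMapsTo i j ≡ countMapsTo i j′
  countMapsTo-offDiagonal-constant {i} {j} {j′} j≢i j′≢i =
    subst₂ (λ a b → countMapsTo a b ≡ countMapsTo i j′) τi≡i (transpose-matchˡ j′ j)
      (countMapsTo-conjugate (transpose j′ j) i j′)
    where
    τi≡i : PC.transpose j′ j i ≡ i
    τi≡i = transpose-fixed (j′≢i ∘ sym) (j≢i ∘ sym)

  countMapsTo-offDiagonal : ∀ {i j} → j ≢ i → (n ∸ 1) * countMapsTo i j ≡ length Dn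
  countMapsTo-offDiagonal {i} {j} j≢i = begin
    (n ∸ 1) * c                  ≡⟨ *-distribʳ-∸ c n 1 ⟩
    n * c ∸ 1 * c                ≡⟨ cong (_∸ 1 * c) n*c≡|Dn|+c ⟩
    length Dn + 1 * c ∸ 1 * c    ≡⟨ m+n∸n≡m (length Dn) (1 * c) ⟩
    length Dn                    ∎
    where
    open ≡-Reasoning
    c = countMapsTo i j
    n*c≡|Dn|+c : n * c ≡ length Dn + 1 * c
    n*c≡|Dn|+c = begin
      n * c                                                  ≡⟨ ∑-allFin-const n c ⟨
      ∑[ j′ ∈ allFin n ] c                                    ≡⟨ ∑-cong (allFin n) (λ {j′} _ → column j′) ⟨
      ∑[ j′ ∈ allFin n ] (countMapsTo i j′ + c * δ j′ i)      ≡⟨ ∑-+ (countMapsTo i) (λ j′ → c * δ j′ i) (allFin n) ⟩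
      ∑ (allFin n) (countMapsTo i) + ∑[ j′ ∈ allFin n ] (c * δ j′ i)
                                                            ≡⟨ cong₂ _+_ (∑-countMapsTo i) (∑-*ˡ c (λ j′ → δ j′ i) (allFin n)) ⟩
      length Dn + c * ∑[ j′ ∈ allFin n ] δ j′ i              ≡⟨ cong (λ s → length Dn + c * s) (∑-δ i) ⟩
      length Dn + c * 1                                      ≡⟨ cong (length Dn +_) (*-comm c 1) ⟩
      length Dn + 1 * c                                      ∎
      where
      -- adding c on the diagonal, where countMapsTo vanishes, makes every column equal to c
      column : ∀ j′ → countMapsTo i j′ + c * δ j′ i ≡ c
      column j′ with j′ ≟ i
      ... | yes refl = trans (cong (_+ c * 1) (countMapsTo-diagonal i)) (*-identityʳ c)
      ... | no j′≢i  = begin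
        countMapsTo i j′ + c * 0  ≡⟨ cong (countMapsTo i j′ +_) (*-zeroʳ c) ⟩
        countMapsTo i j′ + 0      ≡⟨ +-identityʳ _ ⟩
        countMapsTo i j′          ≡⟨ countMapsTo-offDiagonal-constant j′≢i j≢i ⟩
        c                         ∎

proposition3p1 : (n : ℕ) → (σ : Vec (Fin n) n) → IsDerangement σ →
    (Dn : List (Vec (Fin n) n)) → Unique Dn →
    (∀ d → (d ∈ Dn) ⇔ IsDerangement d) →
    (n ∸ 1) * sum (map (J2size σ) Dn) ≡ n * length Dn
proposition3p1 n σ σ-derangement Dn Dn-unique Dn-enumerates = begin
  (n ∸ 1) * ∑ Dn (J2size σ)                                   ≡⟨ cong ((n ∸ 1) *_) ∑J2size≡∑countMapsTo ⟩
  (n ∸ 1) * ∑[ i ∈ allFin n ] countMapsTo i (γ₂ i)              ≡⟨ ∑-*ˡ (n ∸ 1) (λ i → countMapsTo i (γ₂ i)) (allFin n) ⟨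
  ∑[ i ∈ allFin n ] ((n ∸ 1) * countMapsTo i (γ₂ i))            ≡⟨ ∑-cong (allFin n) (λ {i} _ → countMapsTo-offDiagonal (γ₂-fpf i)) ⟩
  ∑[ i ∈ allFin n ] length Dn                                  ≡⟨ ∑-allFin-const n (length Dn) ⟩
  n * length Dn                                                ∎
  where
  open ≡-Reasoning
  open DerangementCounts Dn Dn-unique Dn-enumerates
  guess₂ : Vec (Fin n) n
  guess₂ = nextGuessAllWrong (identityGuess n) σ
  γ₂ : Fin n → Fin n
  γ₂ = lookup guess₂
  γ₂-fpf : ∀ i → γ₂ i ≢ i
  γ₂-fpf = secondGuess-fixedPointFree σ σ-derangement
  ∑J2size≡∑countMapsTo : ∑ Dn (J2size σ) ≡ ∑[ i ∈ allFin n ] countMapsTo i (γ₂ i)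
  ∑J2size≡∑countMapsTo = trans (∑-cong Dn (λ {d} _ → numCorrect≡∑δ guess₂ d))
    (∑-comm (λ d i → δ (γ₂ i) (lookup d i)) Dn (allFin n))
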